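{- Let $G=(V,E)$ be a tree with edge weights $w:E\to\mathbb{R}_+$, and let $T_1,\dots,T_q\subseteq V$ be candidate sets. Consider the greedy algorithm: set $C\gets\emptyset$; while $|C|<q-1$, choose $e\in E\setminus C$ of minimum weight such that $C\cup\{e\}$ is good, and set $C\gets C\cup\{e\}$. This algorithm outputs an optimal solution to the Single-to-Single problem on $G$.
   Context: For the tree $G$, a set of edges $C\subseteq E$ is called good if one can choose $|C|+1$ representatives forming a partial transversal of the candidate sets such that each connected component of $G-C$ contains exactly one of these representatives. A partial transversal means distinct nodes, each taken from a distinct candidate set $T_i$, with each representative belonging to its associated set. Note that $G-C$ has exactly $|C|+1$ components. Single-to-Single: choose $t_i\in T_i$ for each $i\in[q]$ and $C\subseteq E$ such that $t_i,t_j$ are in different components of $G-C$ for all $i\neq j$, minimizing $w(C)$.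
   Formalization: The edge weights take values in the nonnegative rationals rather than in $\mathbb{R}_+$. -}

module Defs where

open import Data.Nat as ℕ using (ℕ; zero; suc; _∸_)
open import Data.Fin using (Fin; zero; suc)
open import Data.Fin.Subset using (Subset; _∈_; _∉_; _∪_; ⁅_⁆; ∣_∣; ⊥)
open import Data.Vec using ([]; _∷_)
open import Data.Bool using (if_then_else_)
open import Data.Product using (Σ; ∃; _×_; _,_)
open import Data.Sum using (_⊎_)
open import Data.Rational as ℚ using (ℚ; 0ℚ; _+_; _≤_)
open import Relation.Binary.PropositionalEquality using (_≡_; _≢_)
open import Relation.Nullary using (¬_)
open import Function using (_∘_)
open import Function.Definitions using (Injective)

record Graph : Set where
  field
    n : ℕ
    m : ℕ
    ends : Fin m → Fin n × Fin n

module _ (G : Graph) where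
  open Graph G

  Joins : Fin m → Fin n → Fin n → Set
  Joins e u x = ends e ≡ (u , x) ⊎ ends e ≡ (x , u)

  data Reach (C : Subset m) : Fin n → Fin n → Set where
    here : ∀ {u} → Reach C u u
    step : ∀ {u x v} (e : Fin m) → e ∉ C → Joins e u x → Reach C x v → Reach C u v

  Connected : Set
  Connected = ∀ u v → Reach ⊥ u v

  -- Tree: connected, and minimally so (every edge is a bridge, i.e. acyclic)
  IsTree : Set
  IsTree = Connected × (∀ e → ¬ (∀ u v → Reach ⁅ e ⁆ u v))

  weight : ∀ {k} → (Fin k → ℚ) → Subset k → ℚ
  weight {zero} w [] = 0ℚ
  weight {suc k} w (b ∷ C) = (if b then w zero else 0ℚ) + weight (w ∘ suc) C

  module _ (q : ℕ) (T : Fin q → Subset n) (w : Fin m → ℚ) where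

    Good : Subset m → Set
    Good C = Σ (Fin (suc ∣ C ∣) → Fin n) λ r → Σ (Fin (suc ∣ C ∣) → Fin q) λ idx →
      Injective _≡_ _≡_ r × Injective _≡_ _≡_ idx × (∀ i → r i ∈ T (idx i)) ×
      (∀ v → Σ (Fin (suc ∣ C ∣)) λ i → Reach C v (r i) × (∀ j → Reach C v (r j) → j ≡ i))

    Feasible : Subset m → Set
    Feasible C = Σ (Fin q → Fin n) λ t → (∀ i → t i ∈ T i) ×
      (∀ i j → i ≢ j → ¬ Reach C (t i) (t j))

    Optimal : Subset m → Set
    Optimal C = Feasible C × (∀ C' → Feasible C' → weight w C ≤ weight w C')

    GreedyStep : Subset m → Fin m → Set
    GreedyStep C e = e ∉ C × Good (C ∪ ⁅ e ⁆) ×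
      (∀ e' → e' ∉ C → Good (C ∪ ⁅ e' ⁆) → w e ≤ w e')

    -- C is reachable by some run of the greedy algorithm (any tie-breaking)
    data GreedyReach : Subset m → Set where
      start : GreedyReach ⊥
      next  : ∀ {C} e → GreedyReach C → ∣ C ∣ ℕ.< q ∸ 1 → GreedyStep C e →
              GreedyReach (C ∪ ⁅ e ⁆)

{-# OPTIONS --safe #-}
-- The good edge sets are the independent sets of a matroid, so greedy is optimal. In a tree,
-- G − C has |C| + 1 components, and C is good when they carry representatives from pairwise
-- distinct candidate sets. Goodness passes to subsets: deleting an edge from C merges two
-- components and loses one representative. It also augments: if A is good and D separates more
-- terminals with distinct labels than G − A has components, then A ∪ {e} is good for some
-- e ∈ D ∖ A. Indeed, take a terminal s whose label no representative uses. Either an edge of D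
-- separates s from the representative of its component of G − A, and after cutting that edge s
-- represents the new component, or s replaces that representative, which makes one more
-- representative a terminal. A feasible solution C′ separates q terminals, so it contains a good
-- set of size q − 1; by the exchange argument every set the greedy algorithm reaches lies in a good
-- set of size q − 1 of weight at most w(C′), and a good set of size q − 1 is feasible.
module Submission where

open import Defs
open import Data.Bool.Properties using (∨-identityʳ)
open import Data.Empty using (⊥-elim)
open import Data.Fin using (Fin; zero; suc; _≟_; punchIn; punchOut)
open import Data.Fin.Properties
  using (any?; all?; ¬∀⟶∃¬; <⇒notInjective; punchIn-injective; punchInᵢ≢i; punchOut-injective; punchIn-punchOut)
open import Data.Fin.Subset as Subset
  using (Subset; inside; outside; _∈_; _∉_; _⊆_; _⊈_; _⊂_; _∪_; ⁅_⁆; ∣_∣; _-_)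
open import Data.Fin.Subset.Properties
open import Data.Fin.Subset.Induction using (⊂-wellFounded; Acc; acc)
open import Data.List using (allFin; filter)
open import Data.List.Relation.Unary.All as All using ()
open import Data.List.Relation.Unary.All.Properties using (all-filter)
open import Data.List.Membership.Propositional.Properties using (∈-allFin; ∈-filter⁺)
open import Data.Nat as ℕ using (ℕ; zero; suc; _<_; _∸_; s≤s)
import Data.Nat.Properties as ℕₚ
open import Data.Product using (Σ; ∃; ∃₂; _×_; _,_; proj₁; proj₂; swap)
open import Data.Product.Properties using (,-injective)
open import Data.Rational using (ℚ; 0ℚ; _+_; _≤_)
import Data.Rational.Properties as ℚₚ
open import Data.Sum using (_⊎_; inj₁; inj₂; [_,_]′)
open import Data.Vec using ([]; _∷_; here; there)
open import Data.Vec.Functional using (updateAt) renaming (_∷_ to _◂_)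
open import Data.Vec.Functional.Properties using (updateAt-updates; updateAt-minimal)
open import Function using (_∘_; const)
open import Function.Definitions using (Injective)
open import Level using (Level)
open import Relation.Binary.PropositionalEquality
open import Relation.Nullary using (¬_; Dec; yes; no)
open import Relation.Nullary.Decidable using (_×-dec_; _→-dec_; map′; ¬?; decidable-stable)
open import Relation.Unary using (Pred; Decidable)
open import Relation.Binary.Bundles using (DecTotalOrder)

open import Data.List.Extrema (DecTotalOrder.totalOrder ℚₚ.≤-decTotalOrder)
  using (argmin; argmin-all; f[argmin]≤f[xs])

private
  variable
    a : Level
    k l N : ℕ
    p q r : Subset N
    x y : Fin N

x∈p∪⁅y⁆∧x≢y⇒x∈p : x ∈ p ∪ ⁅ y ⁆ → x ≢ y → x ∈ p
x∈p∪⁅y⁆∧x≢y⇒x∈p {p = p} {y = y} x∈ x≢y =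
  [ (λ x∈p → x∈p) , ⊥-elim ∘ x≢y ∘ x∈⁅y⁆⇒x≡y y ]′ (x∈p∪q⁻ p ⁅ y ⁆ x∈)

x∉p∪⁅y⁆ : x ∉ p → x ≢ y → x ∉ p ∪ ⁅ y ⁆
x∉p∪⁅y⁆ x∉p x≢y x∈ = x∉p (x∈p∪⁅y⁆∧x≢y⇒x∈p x∈ x≢y)

p⊆q∪⁅x⁆⇒p⊆q : x ∉ p → p ⊆ q ∪ ⁅ x ⁆ → p ⊆ q
p⊆q∪⁅x⁆⇒p⊆q x∉p p⊆q∪⁅x⁆ y∈p = x∈p∪⁅y⁆∧x≢y⇒x∈p (p⊆q∪⁅x⁆ y∈p) λ { refl → x∉p y∈p }

∪-lub : p ⊆ r → q ⊆ r → p ∪ q ⊆ r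
∪-lub {p = p} {q = q} p⊆r q⊆r x∈ = [ p⊆r , q⊆r ]′ (x∈p∪q⁻ p q x∈)

⁅x⁆⊆p : x ∈ p → ⁅ x ⁆ ⊆ p
⁅x⁆⊆p {x = x} {p} x∈p y∈⁅x⁆ = subst (_∈ p) (sym (x∈⁅y⁆⇒x≡y x y∈⁅x⁆)) x∈p

x∈p∪⁅x⁆ : ∀ x → x ∈ p ∪ ⁅ x ⁆
x∈p∪⁅x⁆ {p = p} x = q⊆p∪q p ⁅ x ⁆ (x∈⁅x⁆ x)

p⊂p∪⁅x⁆ : x ∉ p → p ⊂ p ∪ ⁅ x ⁆
p⊂p∪⁅x⁆ {x = x} x∉p = p⊆p∪q ⁅ x ⁆ , x , x∈p∪⁅x⁆ x , x∉p

∣p∪⁅x⁆∣≡1+∣p∣ : x ∉ p → ∣ p ∪ ⁅ x ⁆ ∣ ≡ suc ∣ p ∣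
∣p∪⁅x⁆∣≡1+∣p∣ {x = zero}  {inside  ∷ p} x∉p = ⊥-elim (x∉p here)
∣p∪⁅x⁆∣≡1+∣p∣ {x = zero}  {outside ∷ p} _   = cong (suc ∘ ∣_∣) (∪-identityʳ p)
∣p∪⁅x⁆∣≡1+∣p∣ {x = suc x} {inside  ∷ p} x∉p = cong suc (∣p∪⁅x⁆∣≡1+∣p∣ (x∉p ∘ there))
∣p∪⁅x⁆∣≡1+∣p∣ {x = suc x} {outside ∷ p} x∉p = ∣p∪⁅x⁆∣≡1+∣p∣ (x∉p ∘ there)

x∈p⇒p≡p′∪⁅x⁆ : x ∈ p → ∃ λ p′ → x ∉ p′ × p ≡ p′ ∪ ⁅ x ⁆
x∈p⇒p≡p′∪⁅x⁆ {x = zero}  {inside ∷ p} here = outside ∷ p , (λ ()) , cong (inside ∷_) (sym (∪-identityʳ p))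
x∈p⇒p≡p′∪⁅x⁆ {x = suc x} {s ∷ p} (there x∈p) with p′ , x∉p′ , refl ← x∈p⇒p≡p′∪⁅x⁆ x∈p =
  s ∷ p′ , x∉p′ ∘ drop-there , cong (_∷ _) (sym (∨-identityʳ s))

⊈⇒∃∉ : p ⊈ q → ∃ λ x → x ∈ p × x ∉ q
⊈⇒∃∉ {p = p} {q} p⊈q with x , ¬[x∈p⇒x∈q] ← ¬∀⟶∃¬ _ _ (λ x → x ∈? p →-dec x ∈? q) (λ h → p⊈q (h _))
  with x ∈? p
... | yes x∈p = x , x∈p , ¬[x∈p⇒x∈q] ∘ const
... | no  x∉p = ⊥-elim (¬[x∈p⇒x∈q] (⊥-elim ∘ x∉p))

Subset-induction : (P : Subset N → Set a) → P Subset.⊥ →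
                   (∀ {p x} → x ∉ p → P p → P (p ∪ ⁅ x ⁆)) → ∀ p → P p
Subset-induction P P⊥ P∪⁅x⁆ p = go p (⊂-wellFounded p)
  where
  go : ∀ p → Acc _⊂_ p → P p
  go p (acc smaller) with nonempty? p
  ... | no ¬nonempty = subst P (sym (Empty-unique ¬nonempty)) P⊥
  ... | yes (x , x∈p) with p′ , x∉p′ , refl ← x∈p⇒p≡p′∪⁅x⁆ x∈p =
    P∪⁅x⁆ x∉p′ (go p′ (smaller (p⊂p∪⁅x⁆ x∉p′)))

∃-outside-image : k < l → (f : Fin k → Fin N) {g : Fin l → Fin N} → Injective _≡_ _≡_ g →
                  ∃ λ j → ∀ i → f i ≢ g j
∃-outside-image k<l f {g} g-inj with any? (λ j → all? (λ i → ¬? (f i ≟ g j)))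
... | yes fresh = fresh
... | no ¬fresh = ⊥-elim (<⇒notInjective k<l preimage-injective)
  where
  preimage : ∀ j → ∃ λ i → f i ≡ g j
  preimage j with any? (λ i → f i ≟ g j)
  ... | yes hit = hit
  ... | no ¬hit = ⊥-elim (¬fresh (j , λ i fi≡gj → ¬hit (i , fi≡gj)))
  preimage-injective : Injective _≡_ _≡_ (proj₁ ∘ preimage)
  preimage-injective {j} {j′} eq =
    g-inj (trans (sym (proj₂ (preimage j))) (trans (cong f eq) (proj₂ (preimage j′))))

injective⇒surjective : {f : Fin N → Fin N} → Injective _≡_ _≡_ f → ∀ y → ∃ λ x → f x ≡ y
injective⇒surjective {suc N} {f} f-inj y with any? (λ x → f x ≟ y)
... | yes hit = hit
... | no ¬hit = ⊥-elim (<⇒notInjective (ℕₚ.n<1+n N) punchOut∘f-injective)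
  where
  f≢y : ∀ x → y ≢ f x
  f≢y x y≡fx = ¬hit (x , sym y≡fx)
  punchOut∘f-injective : Injective _≡_ _≡_ (λ x → punchOut (f≢y x))
  punchOut∘f-injective eq = f-inj (punchOut-injective (f≢y _) (f≢y _) eq)

◂-injective : {f : Fin k → Fin N} {x : Fin N} → (∀ i → f i ≢ x) → Injective _≡_ _≡_ f →
              Injective _≡_ _≡_ (x ◂ f)
◂-injective x∉f f-inj {zero}  {zero}  _    = refl
◂-injective x∉f f-inj {zero}  {suc j} x≡fj = ⊥-elim (x∉f j (sym x≡fj))
◂-injective x∉f f-inj {suc i} {zero}  fi≡x = ⊥-elim (x∉f i fi≡x)
◂-injective x∉f f-inj {suc i} {suc j} fi≡fj = cong suc (f-inj fi≡fj)

injective? : (f : Fin k → Fin N) → Dec (Injective _≡_ _≡_ f)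
injective? f = map′ (λ h {x} {y} → h x y) (λ h x y → h)
                    (all? λ x → all? λ y → f x ≟ f y →-dec x ≟ y)

any-function? : {P : Pred (Fin k → Fin N) a} → (∀ {f g} → (∀ i → f i ≡ g i) → P f → P g) →
                Decidable P → Dec (∃ P)
any-function? {zero} resp P? with P? (λ ())
... | yes P[] = yes (_ , P[])
... | no ¬P[] = no λ (f , Pf) → ¬P[] (resp (λ ()) Pf)
any-function? {suc k} resp P? with any? (λ x → any-function? (resp ∘ ◂-cong) (P? ∘ (x ◂_)))
  where
  ◂-cong : ∀ {x f g} → (∀ i → f i ≡ g i) → ∀ i → (x ◂ f) i ≡ (x ◂ g) i
  ◂-cong f≗g zero    = refl
  ◂-cong f≗g (suc i) = f≗g i
... | yes (x , f , P[x◂f]) = yes (x ◂ f , P[x◂f])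
... | no ¬∃ = no λ (f , Pf) → ¬∃ (f zero , f ∘ suc , resp (λ { zero → refl ; (suc i) → refl }) Pf)

minimiser : {P : Pred (Fin k) a} → Decidable P → (w : Fin k → ℚ) → ∃ P →
            ∃ λ e → P e × ∀ e′ → P e′ → w e ≤ w e′
minimiser {k} P? w (e₀ , Pe₀) =
  e , argmin-all w Pe₀ (all-filter P? (allFin k)) ,
  λ e′ Pe′ → All.lookup (f[argmin]≤f[xs] e₀ candidates) (∈-filter⁺ P? (∈-allFin e′) Pe′)
  where
  candidates = filter P? (allFin k)
  e = argmin w e₀ candidates

module Walks (G : Graph) where
  open Graph G

  private
    variable
      C D : Subset m
      e : Fin m
      u v w u′ v′ : Fin n

  Joins-sym : Joins G e u v → Joins G e v u
  Joins-sym (inj₁ ends≡uv) = inj₂ ends≡uv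
  Joins-sym (inj₂ ends≡vu) = inj₁ ends≡vu

  Joins-unique : Joins G e u v → Joins G e u′ v′ → (u ≡ u′ × v ≡ v′) ⊎ (u ≡ v′ × v ≡ u′)
  Joins-unique (inj₁ p) (inj₁ q) = inj₁ (,-injective (trans (sym p) q))
  Joins-unique (inj₁ p) (inj₂ q) = inj₂ (,-injective (trans (sym p) q))
  Joins-unique (inj₂ p) (inj₁ q) = inj₂ (swap (,-injective (trans (sym p) q)))
  Joins-unique (inj₂ p) (inj₂ q) = inj₁ (swap (,-injective (trans (sym p) q)))

  Reach-trans : Reach G C u v → Reach G C v w → Reach G C u w
  Reach-trans here             q = q
  Reach-trans (step e e∉C j p) q = step e e∉C j (Reach-trans p q)

  Reach-sym : Reach G C u v → Reach G C v u
  Reach-sym here             = here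
  Reach-sym (step e e∉C j p) = Reach-trans (Reach-sym p) (step e e∉C (Joins-sym j) here)

  Reach-anti : D ⊆ C → Reach G C u v → Reach G D u v
  Reach-anti D⊆C here             = here
  Reach-anti D⊆C (step e e∉C j p) = step e (e∉C ∘ D⊆C) j (Reach-anti D⊆C p)

  avoid-e : Reach G (C ∪ ⁅ e ⁆) u v → Reach G ⁅ e ⁆ u v
  avoid-e {C} {e} = Reach-anti (q⊆p∪q C ⁅ e ⁆)

  avoid-C : Reach G (C ∪ ⁅ e ⁆) u v → Reach G C u v
  avoid-C {C} {e} = Reach-anti (p⊆p∪q ⁅ e ⁆)

  avoid-or-cross : Reach G C u v → Reach G (C ∪ ⁅ e ⁆) u v ⊎
                   ∃₂ λ a b → Joins G e a b × Reach G (C ∪ ⁅ e ⁆) u a × Reach G (C ∪ ⁅ e ⁆) b v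
  avoid-or-cross here = inj₁ here
  avoid-or-cross {e = e} (step f f∉C j rest) with f ≟ e | avoid-or-cross rest
  ... | no f≢e | inj₁ rest′ = inj₁ (step f (x∉p∪⁅y⁆ f∉C f≢e) j rest′)
  ... | no f≢e | inj₂ (a , b , j′ , to-a , from-b) =
    inj₂ (a , b , j′ , step f (x∉p∪⁅y⁆ f∉C f≢e) j to-a , from-b)
  ... | yes refl | inj₁ rest′ = inj₂ (_ , _ , j , here , rest′)
  ... | yes refl | inj₂ (a , b , j′ , to-a , from-b) with Joins-unique j j′
  ...   | inj₁ (refl , refl) = inj₂ (_ , _ , j , here , from-b)
  ...   | inj₂ (refl , refl) = inj₁ from-b

module TreeConnectivity (G : Graph) (tree : IsTree G) where
  open Graph G
  open Walks G

  private
    variable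
      C : Subset m
      e : Fin m
      u v w : Fin n

  sides : Joins G e u w → ∀ v → Reach G ⁅ e ⁆ v u ⊎ Reach G ⁅ e ⁆ v w
  sides j v with avoid-or-cross (proj₁ tree v _)
  ... | inj₁ v~u = inj₁ (avoid-e v~u)
  ... | inj₂ (a , _ , j′ , v~a , _) with Joins-unique j′ j
  ...   | inj₁ (refl , _) = inj₁ (avoid-e v~a)
  ...   | inj₂ (refl , _) = inj₂ (avoid-e v~a)

  bridge : Joins G e u w → ¬ Reach G ⁅ e ⁆ u w
  bridge {e} {u} j u~w = proj₂ tree e λ a b → Reach-trans (to-u a) (Reach-sym (to-u b))
    where
    to-u : ∀ a → Reach G ⁅ e ⁆ a u
    to-u a = [ (λ a~u → a~u) , (λ a~w → Reach-trans a~w (Reach-sym u~w)) ]′ (sides j a)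

  reach⁅⁆? : ∀ e u v → Dec (Reach G ⁅ e ⁆ u v)
  reach⁅⁆? e u v with sides j u | sides j v
    where
    j : Joins G e (proj₁ (ends e)) (proj₂ (ends e))
    j = inj₁ refl
  ... | inj₁ u~a | inj₁ v~a = yes (Reach-trans u~a (Reach-sym v~a))
  ... | inj₂ u~b | inj₂ v~b = yes (Reach-trans u~b (Reach-sym v~b))
  ... | inj₁ u~a | inj₂ v~b = no λ u~v →
    bridge (inj₁ refl) (Reach-trans (Reach-sym u~a) (Reach-trans u~v v~b))
  ... | inj₂ u~b | inj₁ v~a = no λ u~v →
    bridge (inj₁ refl) (Reach-trans (Reach-sym v~a) (Reach-trans (Reach-sym u~v) u~b))

  Reach-∪⁅⁆ : Reach G C u v → Reach G ⁅ e ⁆ u v → Reach G (C ∪ ⁅ e ⁆) u v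
  Reach-∪⁅⁆ u~v u~ₑv with avoid-or-cross u~v
  ... | inj₁ u~v′ = u~v′
  ... | inj₂ (a , b , j , u~a , b~v) =
    ⊥-elim (bridge j (Reach-trans (Reach-sym (avoid-e u~a)) (Reach-trans u~ₑv (Reach-sym (avoid-e b~v)))))

  reach-or-separating-edge : ∀ D u v → Reach G D u v ⊎ ∃ λ e → e ∈ D × ¬ Reach G ⁅ e ⁆ u v
  reach-or-separating-edge D u v = Subset-induction _ (inj₁ (proj₁ tree u v)) add-edge D
    where
    add-edge : ∀ {D e} → e ∉ D → Reach G D u v ⊎ (∃ λ f → f ∈ D × ¬ Reach G ⁅ f ⁆ u v) →
               Reach G (D ∪ ⁅ e ⁆) u v ⊎ ∃ λ f → f ∈ D ∪ ⁅ e ⁆ × ¬ Reach G ⁅ f ⁆ u v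
    add-edge {e = e} _ (inj₂ (f , f∈D , f-sep)) = inj₂ (f , p⊆p∪q ⁅ e ⁆ f∈D , f-sep)
    add-edge {e = e} _ (inj₁ u~v) with reach⁅⁆? e u v
    ... | yes u~ₑv = inj₁ (Reach-∪⁅⁆ u~v u~ₑv)
    ... | no  e-sep = inj₂ (e , x∈p∪⁅x⁆ e , e-sep)

  reach? : ∀ D u v → Dec (Reach G D u v)
  reach? D u v with reach-or-separating-edge D u v
  ... | inj₁ u~v = yes u~v
  ... | inj₂ (e , e∈D , e-sep) = no (e-sep ∘ Reach-anti (⁅x⁆⊆p e∈D))

module Families (G : Graph) (q : ℕ) (T : Fin q → Subset (Graph.n G)) where
  open Graph G
  open Walks G

  record Separated (k : ℕ) (C : Subset m) : Set where
    field
      point           : Fin k → Fin n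
      label           : Fin k → Fin q
      label-injective : Injective _≡_ _≡_ label
      point∈T         : ∀ i → point i ∈ T (label i)
      separated       : ∀ {i j} → Reach G C (point i) (point j) → i ≡ j

  record Representatives (k : ℕ) (C : Subset m) : Set where
    field
      family   : Separated k C
    open Separated family public
    field
      covering : ∀ v → ∃ λ i → Reach G C v (point i)

  open Representatives

  private
    variable
      A D : Subset m
      e : Fin m
      s : Fin n
      ℓ : Fin q

  cut : (R : Representatives k A) (i : Fin k) → Reach G A s (point R i) →
        ¬ Reach G (A ∪ ⁅ e ⁆) s (point R i) → s ∈ T ℓ → (∀ j → label R j ≢ ℓ) →
        Representatives (suc k) (A ∪ ⁅ e ⁆)
  cut {k} {A} {s} {e} {ℓ} R i s~i s≁i s∈T ℓ-fresh = record
    { family = record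
      { point           = s ◂ point R
      ; label           = ℓ ◂ label R
      ; label-injective = ◂-injective ℓ-fresh (label-injective R)
      ; point∈T         = λ { zero → s∈T ; (suc j) → point∈T R j }
      ; separated       = separated′
      }
    ; covering = covering′
    }
    where
    s≁ : ∀ {j} → ¬ Reach G (A ∪ ⁅ e ⁆) s (point R j)
    s≁ s~j with separated R (Reach-trans (Reach-sym s~i) (avoid-C s~j))
    ... | refl = s≁i s~j

    separated′ : ∀ {a b} → Reach G (A ∪ ⁅ e ⁆) ((s ◂ point R) a) ((s ◂ point R) b) → a ≡ b
    separated′ {zero}  {zero}  _   = refl
    separated′ {zero}  {suc b} s~b = ⊥-elim (s≁ s~b)
    separated′ {suc a} {zero}  a~s = ⊥-elim (s≁ (Reach-sym a~s))
    separated′ {suc a} {suc b} a~b = cong suc (separated R (avoid-C a~b))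

    crossing : ∃₂ λ a b → Joins G e a b × Reach G (A ∪ ⁅ e ⁆) s a × Reach G (A ∪ ⁅ e ⁆) b (point R i)
    crossing with avoid-or-cross s~i
    ... | inj₁ s~ᵉi = ⊥-elim (s≁i s~ᵉi)
    ... | inj₂ s-crosses = s-crosses

    covering′ : ∀ v → ∃ λ a → Reach G (A ∪ ⁅ e ⁆) v ((s ◂ point R) a)
    covering′ v with covering R v
    ... | c , v~c with avoid-or-cross v~c
    ...   | inj₁ v~ᵉc = suc c , v~ᵉc
    ...   | inj₂ (a , _ , j , v~a , _) with crossing
    ...     | (_ , _ , j′ , s~a′ , b′~i) with Joins-unique j j′
    ...       | inj₁ (refl , _) = zero , Reach-trans v~a (Reach-sym s~a′)
    ...       | inj₂ (refl , _) = suc i , Reach-trans v~a b′~i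

  exchange : (R : Representatives k A) (i : Fin k) → Reach G A s (point R i) → s ∈ T ℓ →
             (∀ j → label R j ≢ ℓ) → Representatives k A
  exchange {k} {A} {s} {ℓ} R i s~i s∈T ℓ-fresh = record
    { family = record
      { point           = point′
      ; label           = label′
      ; label-injective = label′-injective
      ; point∈T         = point′∈T
      ; separated       = λ {a} {b} a~b →
          separated R (Reach-trans (Reach-sym (moved a)) (Reach-trans a~b (moved b)))
      }
    ; covering = λ v → let c , v~c = covering R v in c , Reach-trans v~c (Reach-sym (moved c))
    }
    where
    point′ = updateAt (point R) i (const s)
    label′ = updateAt (label R) i (const ℓ)

    moved : ∀ a → Reach G A (point′ a) (point R a)
    moved a with a ≟ i
    ... | yes refl = subst (λ v → Reach G A v (point R a)) (sym (updateAt-updates a (point R))) s~i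
    ... | no  a≢i  = subst (λ v → Reach G A v (point R a)) (sym (updateAt-minimal a i (point R) a≢i)) here

    point′∈T : ∀ a → point′ a ∈ T (label′ a)
    point′∈T a with a ≟ i
    ... | yes refl = subst₂ (λ v ℓ′ → v ∈ T ℓ′) (sym (updateAt-updates a (point R)))
                            (sym (updateAt-updates a (label R))) s∈T
    ... | no  a≢i  = subst₂ (λ v ℓ′ → v ∈ T ℓ′) (sym (updateAt-minimal a i (point R) a≢i))
                            (sym (updateAt-minimal a i (label R) a≢i)) (point∈T R a)

    label′-injective : Injective _≡_ _≡_ label′
    label′-injective {a} {b} eq with a ≟ i | b ≟ i
    ... | yes refl | yes refl = refl
    ... | yes refl | no  b≢i  = ⊥-elim (ℓ-fresh b (sym (trans (sym (updateAt-updates a (label R)))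
                                        (trans eq (updateAt-minimal b i (label R) b≢i)))))
    ... | no  a≢i  | yes refl = ⊥-elim (ℓ-fresh a (trans (sym (updateAt-minimal a i (label R) a≢i))
                                        (trans eq (updateAt-updates b (label R)))))
    ... | no  a≢i  | no  b≢i  = label-injective R (trans (sym (updateAt-minimal a i (label R) a≢i))
                                        (trans eq (updateAt-minimal b i (label R) b≢i)))

  module _ (tree : IsTree G) where
    open TreeConnectivity G tree

    uncut : e ∉ A → Representatives (suc k) (A ∪ ⁅ e ⁆) → Representatives k A
    uncut {e} {A} {k} e∉A R = record
      { family = record
        { point           = point R ∘ punchIn jᵥ
        ; label           = label R ∘ punchIn jᵥ
        ; label-injective = punchIn-injective jᵥ _ _ ∘ label-injective R
        ; point∈T         = point∈T R ∘ punchIn jᵥ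
        ; separated       = separated′
        }
      ; covering = covering′
      }
      where
      u = proj₁ (ends e)
      v = proj₂ (ends e)
      j : Joins G e u v
      j = inj₁ refl
      iᵤ = proj₁ (covering R u)
      jᵥ = proj₁ (covering R v)
      u~iᵤ = proj₂ (covering R u)
      v~jᵥ = proj₂ (covering R v)

      jᵥ≢iᵤ : jᵥ ≢ iᵤ
      jᵥ≢iᵤ jᵥ≡iᵤ =
        bridge j (avoid-e (Reach-trans u~iᵤ (Reach-sym (subst (Reach G _ v ∘ point R) jᵥ≡iᵤ v~jᵥ))))

      separated′ : ∀ {a b} → Reach G A (point R (punchIn jᵥ a)) (point R (punchIn jᵥ b)) → a ≡ b
      separated′ {a} {b} a~b with avoid-or-cross a~b
      ... | inj₁ a~ᵉb = punchIn-injective jᵥ a b (separated R a~ᵉb)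
      ... | inj₂ (_ , _ , j′ , a~u′ , v′~b) with Joins-unique j′ j
      ...   | inj₁ (refl , refl) = ⊥-elim (punchInᵢ≢i jᵥ b (separated R (Reach-trans (Reach-sym v′~b) v~jᵥ)))
      ...   | inj₂ (refl , refl) = ⊥-elim (punchInᵢ≢i jᵥ a (separated R (Reach-trans a~u′ v~jᵥ)))

      covering′ : ∀ x → ∃ λ a → Reach G A x (point R (punchIn jᵥ a))
      covering′ x with covering R x
      ... | c , x~c with jᵥ ≟ c
      ...   | no jᵥ≢c  = punchOut jᵥ≢c ,
                           subst (Reach G A x ∘ point R) (sym (punchIn-punchOut jᵥ≢c)) (avoid-C x~c)
      ...   | yes refl = punchOut jᵥ≢iᵤ , subst (Reach G A x ∘ point R) (sym (punchIn-punchOut jᵥ≢iᵤ))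
                           (Reach-trans (avoid-C x~c) (Reach-trans (Reach-sym (avoid-C v~jᵥ))
                             (step e e∉A (Joins-sym j) (avoid-C u~iᵤ))))

    augment : Representatives k A → Separated l D → k < l →
              ∃ λ e → e ∈ D × e ∉ A × Representatives (suc k) (A ∪ ⁅ e ⁆)
    augment {k} {A} {l} {D} R₀ F k<l = go R₀ Subset.⊤ (⊂-wellFounded _) (λ a∉⊤ → ⊥-elim (a∉⊤ ∈⊤))
      where
      module F = Separated F

      Matched : Representatives k A → Fin k → Set
      Matched R a = ∃ λ b → point R a ≡ F.point b × label R a ≡ F.label b

      -- Every index outside U is matched; each exchange matches some i ∈ U and removes it from U.
      go : (R : Representatives k A) (U : Subset k) → Acc _⊂_ U → (∀ {a} → a ∉ U → Matched R a) →
           ∃ λ e → e ∈ D × e ∉ A × Representatives (suc k) (A ∪ ⁅ e ⁆)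
      go R U (acc smaller) matched with ∃-outside-image k<l (label R) F.label-injective
      ... | j , ℓ-fresh with covering R (F.point j)
      ...   | i , s~i with reach-or-separating-edge D (F.point j) (point R i)
      ...     | inj₂ (e , e∈D , e-sep) =
        e , e∈D , (λ e∈A → e-sep (Reach-anti (⁅x⁆⊆p e∈A) s~i)) ,
        cut R i s~i (e-sep ∘ avoid-e) (F.point∈T j) ℓ-fresh
      ...     | inj₁ s~ᴰi =
        go (exchange R i s~i (F.point∈T j) ℓ-fresh) (U - i) (smaller (x∈p⇒p-x⊂p i∈U)) matched′
        where
        i∈U : i ∈ U
        i∈U with i ∈? U
        ... | yes i∈U = i∈U
        ... | no  i∉U with b , i≡b , ℓᵢ≡ℓᵦ ← matched i∉U
          with refl ← F.separated (subst (Reach G D (F.point j)) i≡b s~ᴰi) = ⊥-elim (ℓ-fresh i ℓᵢ≡ℓᵦ)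

        matched′ : ∀ {a} → a ∉ U - i → Matched (exchange R i s~i (F.point∈T j) ℓ-fresh) a
        matched′ {a} a∉U-i with a ≟ i
        ... | yes refl = j , updateAt-updates a (point R) , updateAt-updates a (label R)
        ... | no  a≢i with b , a≡b , ℓₐ≡ℓᵦ ← matched (a∉U-i ∘ λ a∈U → x∈p∧x≢y⇒x∈p-y a∈U a≢i) =
          b , trans (updateAt-minimal a i (point R) a≢i) a≡b , trans (updateAt-minimal a i (label R) a≢i) ℓₐ≡ℓᵦ

module _ (G : Graph) where

  weight-mono : (w : Fin N → ℚ) → (∀ e → 0ℚ ≤ w e) → p ⊆ q → weight G w p ≤ weight G w q
  weight-mono {p = []}          {[]}          w w≥0 _   = ℚₚ.≤-refl
  weight-mono {p = inside ∷ p}  {inside ∷ q}  w w≥0 p⊆q =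
    ℚₚ.+-monoʳ-≤ (w zero) (weight-mono (w ∘ suc) (w≥0 ∘ suc) (drop-∷-⊆ p⊆q))
  weight-mono {p = outside ∷ p} {outside ∷ q} w w≥0 p⊆q =
    ℚₚ.+-monoʳ-≤ 0ℚ (weight-mono (w ∘ suc) (w≥0 ∘ suc) (drop-∷-⊆ p⊆q))
  weight-mono {p = outside ∷ p} {inside ∷ q}  w w≥0 p⊆q =
    ℚₚ.+-mono-≤ (w≥0 zero) (weight-mono (w ∘ suc) (w≥0 ∘ suc) (drop-∷-⊆ p⊆q))
  weight-mono {p = inside ∷ p}  {outside ∷ q} w w≥0 p⊆q with () ← p⊆q here

  weight-∪⁅⁆ : (w : Fin N → ℚ) → x ∉ p → weight G w (p ∪ ⁅ x ⁆) ≡ weight G w p + w x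
  weight-∪⁅⁆ {x = zero}  {inside  ∷ p} w x∉p = ⊥-elim (x∉p here)
  weight-∪⁅⁆ {x = zero}  {outside ∷ p} w _   = begin
    w zero + weight G (w ∘ suc) (p ∪ Subset.⊥) ≡⟨ cong (λ r → w zero + weight G (w ∘ suc) r) (∪-identityʳ p) ⟩
    w zero + weight G (w ∘ suc) p              ≡⟨ ℚₚ.+-comm (w zero) _ ⟩
    weight G (w ∘ suc) p + w zero              ≡⟨ cong (_+ w zero) (sym (ℚₚ.+-identityˡ (weight G (w ∘ suc) p))) ⟩
    (0ℚ + weight G (w ∘ suc) p) + w zero       ∎
    where open ≡-Reasoning
  weight-∪⁅⁆ {x = suc x} {inside  ∷ p} w x∉p =
    trans (cong (w zero +_) (weight-∪⁅⁆ (w ∘ suc) (x∉p ∘ there)))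
          (sym (ℚₚ.+-assoc (w zero) (weight G (w ∘ suc) p) (w (suc x))))
  weight-∪⁅⁆ {x = suc x} {outside ∷ p} w x∉p =
    trans (cong (0ℚ +_) (weight-∪⁅⁆ (w ∘ suc) (x∉p ∘ there)))
          (sym (ℚₚ.+-assoc 0ℚ (weight G (w ∘ suc) p) (w (suc x))))

  weight-exchange : (w : Fin N → ℚ) → (∀ e → 0ℚ ≤ w e) → x ∉ p → y ∉ p → q ⊆ p ∪ ⁅ x ⁆ → w x ≤ w y →
                    weight G w q ≤ weight G w (p ∪ ⁅ y ⁆)
  weight-exchange {x = x} {p} {y} {q} w w≥0 x∉p y∉p q⊆p∪⁅x⁆ wx≤wy = begin
    weight G w q             ≤⟨ weight-mono w w≥0 q⊆p∪⁅x⁆ ⟩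
    weight G w (p ∪ ⁅ x ⁆)   ≡⟨ weight-∪⁅⁆ w x∉p ⟩
    weight G w p + w x       ≤⟨ ℚₚ.+-monoʳ-≤ (weight G w p) wx≤wy ⟩
    weight G w p + w y       ≡⟨ weight-∪⁅⁆ w y∉p ⟨
    weight G w (p ∪ ⁅ y ⁆)   ∎
    where open ℚₚ.≤-Reasoning

module GoodSets (G : Graph) (tree : IsTree G) (q : ℕ) (T : Fin q → Subset (Graph.n G))
                (w : Fin (Graph.m G) → ℚ) where
  open Graph G
  open Walks G
  open TreeConnectivity G tree
  open Families G q T
  open Representatives

  private
    variable
      C D X Y : Subset m

  Good⇒Representatives : Good G q T w C → Representatives (suc ∣ C ∣) C
  Good⇒Representatives (r , idx , _ , idx-injective , r∈T , cover) = record
    { family = record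
      { point           = r
      ; label           = idx
      ; label-injective = idx-injective
      ; point∈T         = r∈T
      ; separated       = λ {i} {j} i~j → let _ , _ , unique = cover (r i) in
                                          trans (unique i here) (sym (unique j i~j))
      }
    ; covering = λ v → let i , v~i , _ = cover v in i , v~i
    }

  Representatives⇒Good : k ≡ suc ∣ C ∣ → Representatives k C → Good G q T w C
  Representatives⇒Good {C = C} refl R =
    point R , label R ,
    (λ {a} point-a≡point-b → separated R (subst (Reach G C (point R a)) point-a≡point-b here)) ,
    label-injective R , point∈T R ,
    λ v → let i , v~i = covering R v in
          i , v~i , λ j v~j → separated R (Reach-trans (Reach-sym v~j) v~i)

  Representatives⇒Feasible : Representatives q C → Feasible G q T w C
  Representatives⇒Feasible {C} R =
    point R ∘ owner ,
    (λ ℓ → subst (λ ℓ′ → point R (owner ℓ) ∈ T ℓ′) (proj₂ (label-surjective ℓ)) (point∈T R (owner ℓ))) ,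
    λ ℓ ℓ′ ℓ≢ℓ′ ℓ~ℓ′ → ℓ≢ℓ′ (trans (sym (proj₂ (label-surjective ℓ)))
                              (trans (cong (label R) (separated R ℓ~ℓ′)) (proj₂ (label-surjective ℓ′))))
    where
    label-surjective = injective⇒surjective (label-injective R)
    owner = proj₁ ∘ label-surjective

  Good-⊥ : ∀ {v} ℓ → v ∈ T ℓ → Good G q T w Subset.⊥
  Good-⊥ {v} ℓ v∈T = Representatives⇒Good (cong suc (sym (∣⊥∣≡0 m))) record
    { family = record
      { point           = const v
      ; label           = const ℓ
      ; label-injective = λ { {zero} {zero} _ → refl }
      ; point∈T         = const v∈T
      ; separated       = λ { {zero} {zero} _ → refl }
      }
    ; covering = λ u → zero , proj₁ tree u v
    }

  Good-∪⁅⁆ : ∀ {e} → e ∉ C → Representatives (suc (suc ∣ C ∣)) (C ∪ ⁅ e ⁆) → Good G q T w (C ∪ ⁅ e ⁆)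
  Good-∪⁅⁆ e∉C = Representatives⇒Good (cong suc (sym (∣p∪⁅x⁆∣≡1+∣p∣ e∉C)))

  Good-∪⁅⁆⁻ : ∀ {e} → e ∉ C → Good G q T w (C ∪ ⁅ e ⁆) → Good G q T w C
  Good-∪⁅⁆⁻ {C} {e} e∉C good =
    Representatives⇒Good refl (uncut tree e∉C (subst (λ k → Representatives k (C ∪ ⁅ e ⁆))
                                                     (cong suc (∣p∪⁅x⁆∣≡1+∣p∣ e∉C))
                                                     (Good⇒Representatives good)))

  Good-⊆ : Y ⊆ X → Good G q T w X → Good G q T w Y
  Good-⊆ {Y} {X} = go X (⊂-wellFounded X)
    where
    go : ∀ X → Acc _⊂_ X → Y ⊆ X → Good G q T w X → Good G q T w Y
    go X (acc smaller) Y⊆X good with X ⊆? Y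
    ... | yes X⊆Y = subst (Good G q T w) (⊆-antisym X⊆Y Y⊆X) good
    ... | no  X⊈Y with f , f∈X , f∉Y ← ⊈⇒∃∉ X⊈Y with X′ , f∉X′ , refl ← x∈p⇒p≡p′∪⁅x⁆ f∈X =
      go X′ (smaller (p⊂p∪⁅x⁆ f∉X′)) (p⊆q∪⁅x⁆⇒p⊆q f∉Y Y⊆X) (Good-∪⁅⁆⁻ f∉X′ good)

  good? : ∀ C → Dec (Good G q T w C)
  good? C = any-function? (λ r≗r′ (idx , body) → idx , body-cong r≗r′ (λ _ → refl) body) λ r →
            any-function? (body-cong (λ _ → refl)) λ idx →
            injective? r ×-dec injective? idx ×-dec all? (λ i → r i ∈? T (idx i)) ×-dec
            all? λ v → any? λ i → reach? C v (r i) ×-dec all? λ j → reach? C v (r j) →-dec j ≟ i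
    where
    Body : (Fin (suc ∣ C ∣) → Fin n) → (Fin (suc ∣ C ∣) → Fin q) → Set
    Body r idx = Injective _≡_ _≡_ r × Injective _≡_ _≡_ idx × (∀ i → r i ∈ T (idx i)) ×
                 (∀ v → Σ (Fin (suc ∣ C ∣)) λ i → Reach G C v (r i) × (∀ j → Reach G C v (r j) → j ≡ i))

    body-cong : ∀ {r r′ idx idx′} → (∀ i → r i ≡ r′ i) → (∀ i → idx i ≡ idx′ i) → Body r idx → Body r′ idx′
    body-cong r≗r′ idx≗idx′ (r-injective , idx-injective , r∈T , cover) =
      (λ eq → r-injective (trans (r≗r′ _) (trans eq (sym (r≗r′ _))))) ,
      (λ eq → idx-injective (trans (idx≗idx′ _) (trans eq (sym (idx≗idx′ _))))) ,
      (λ i → subst₂ (λ v ℓ → v ∈ T ℓ) (r≗r′ i) (idx≗idx′ i) (r∈T i)) ,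
      λ v → let i , v~i , unique = cover v in
            i , subst (Reach G C v) (r≗r′ i) v~i ,
            λ j v~j → unique j (subst (Reach G C v) (sym (r≗r′ j)) v~j)

  augment-good : Good G q T w C → Separated l D → suc ∣ C ∣ < l →
                 ∃ λ e → e ∈ D × e ∉ C × Good G q T w (C ∪ ⁅ e ⁆)
  augment-good good F lt with e , e∈D , e∉C , R ← augment tree (Good⇒Representatives good) F lt =
    e , e∈D , e∉C , Good-∪⁅⁆ e∉C R

  extend-good : ∀ gap → gap ℕ.+ ∣ C ∣ ≡ k → Separated (suc k) D → Good G q T w C →
                ∃ λ B → Good G q T w B × ∣ B ∣ ≡ k × C ⊆ B × B ⊆ C ∪ D
  extend-good zero      size F good = _ , good , size , (λ x∈C → x∈C) , p⊆p∪q _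
  extend-good {C} (suc gap) size F good
    with e , e∈D , e∉C , good′ ←
           augment-good good F (s≤s (subst (∣ C ∣ <_) size (s≤s (ℕₚ.m≤n+m ∣ C ∣ gap))))
    with B , good-B , ∣B∣≡k , C∪⁅e⁆⊆B , B⊆ ←
           extend-good gap (trans (cong (gap ℕ.+_) (∣p∪⁅x⁆∣≡1+∣p∣ e∉C)) (trans (ℕₚ.+-suc gap ∣ C ∣) size))
                       F good′
    = B , good-B , ∣B∣≡k , C∪⁅e⁆⊆B ∘ p⊆p∪q _ ,
      ⊆-trans B⊆ (∪-lub (∪-lub (p⊆p∪q _) (⁅x⁆⊆p (q⊆p∪q _ _ e∈D))) (q⊆p∪q _ _))

module Greedy (G : Graph) (tree : IsTree G) (p : ℕ) (T : Fin (suc p) → Subset (Graph.n G))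
              (w : Fin (Graph.m G) → ℚ) (w≥0 : ∀ e → 0ℚ ≤ w e) where
  open Graph G
  open Families G (suc p) T
  open GoodSets G tree (suc p) T w

  private
    variable
      C C′ : Subset m
      e : Fin m

  Feasible⇒Separated : Feasible G (suc p) T w C → Separated (suc p) C
  Feasible⇒Separated (t , t∈T , t-separated) = record
    { point           = t
    ; label           = λ i → i
    ; label-injective = λ i≡j → i≡j
    ; point∈T         = t∈T
    ; separated       = λ {i} {j} i~j → decidable-stable (i ≟ j) λ i≢j → t-separated i j i≢j i~j
    }

  record CheapBasis (C′ C : Subset m) : Set where
    field
      basis  : Subset m
      good   : Good G (suc p) T w basis
      size   : ∣ basis ∣ ≡ p
      ⊆basis : C ⊆ basis
      cheap  : weight G w basis ≤ weight G w C′

    separated-family : Separated (suc p) basis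
    separated-family = subst (λ k → Separated (suc k) basis) size
                             (Representatives.family (Good⇒Representatives good))

    good-subset : Good G (suc p) T w C
    good-subset = Good-⊆ ⊆basis good

  open CheapBasis

  cheapBasis-⊥ : Feasible G (suc p) T w C′ → CheapBasis C′ Subset.⊥
  cheapBasis-⊥ {C′} feasible@(_ , t∈T , _)
    with B , good-B , ∣B∣≡p , _ , B⊆⊥∪C′ ←
           extend-good p (trans (cong (p ℕ.+_) (∣⊥∣≡0 m)) (ℕₚ.+-identityʳ p))
                       (Feasible⇒Separated feasible) (Good-⊥ zero (t∈T zero))
    = record
      { basis  = B
      ; good   = good-B
      ; size   = ∣B∣≡p
      ; ⊆basis = ⊆-min B
      ; cheap  = weight-mono G w w≥0 (⊆-trans B⊆⊥∪C′ (∪-lub (⊆-min C′) (λ x∈C′ → x∈C′)))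
      }

  -- Extending C ∪ {e} inside C ∪ {e} ∪ B gives D ⊆ (B − f) ∪ {e} for some f ∈ B ∖ D, and
  -- w e ≤ w f because greedy chose e while C ∪ {f} ⊆ B was good.
  cheapBasis-exchange : (cb : CheapBasis C′ C) → ∣ C ∣ < p → GreedyStep G (suc p) T w C e →
                        e ∉ basis cb → CheapBasis C′ (C ∪ ⁅ e ⁆)
  cheapBasis-exchange {C′} {C} {e} cb@record { basis = B ; good = good-B ; ⊆basis = C⊆B ; cheap = B-cheap }
                      ∣C∣<p (e∉C , good-C∪⁅e⁆ , e-minimal) e∉B
    with D , good-D , ∣D∣≡p , C∪⁅e⁆⊆D , D⊆C∪⁅e⁆∪B ←
           extend-good (p ∸ suc ∣ C ∣) (trans (cong (p ∸ suc ∣ C ∣ ℕ.+_) (∣p∪⁅x⁆∣≡1+∣p∣ e∉C))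
                                                (ℕₚ.m∸n+n≡m ∣C∣<p))
                       (separated-family cb) good-C∪⁅e⁆
    with f , f∈B , f∉D ← ⊈⇒∃∉ {p = B} {q = D} (λ B⊆D →
           ℕₚ.<-irrefl (trans (size cb) (sym ∣D∣≡p))
                       (p⊂q⇒∣p∣<∣q∣ (B⊆D , e , C∪⁅e⁆⊆D (x∈p∪⁅x⁆ e) , e∉B)))
    with B′ , f∉B′ , refl ← x∈p⇒p≡p′∪⁅x⁆ f∈B
    = record
      { basis  = D
      ; good   = good-D
      ; size   = ∣D∣≡p
      ; ⊆basis = C∪⁅e⁆⊆D
      ; cheap  = ℚₚ.≤-trans (weight-exchange G w w≥0 (e∉B ∘ p⊆p∪q ⁅ f ⁆) f∉B′ D⊆B′∪⁅e⁆ we≤wf) B-cheap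
      }
    where
    we≤wf : w e ≤ w f
    we≤wf = e-minimal f (f∉D ∘ C∪⁅e⁆⊆D ∘ p⊆p∪q ⁅ e ⁆) (Good-⊆ (∪-lub C⊆B (⁅x⁆⊆p f∈B)) good-B)

    B⊆B′∪⁅e⁆∪⁅f⁆ : B′ ∪ ⁅ f ⁆ ⊆ (B′ ∪ ⁅ e ⁆) ∪ ⁅ f ⁆
    B⊆B′∪⁅e⁆∪⁅f⁆ = ∪-lub (p⊆p∪q ⁅ f ⁆ ∘ p⊆p∪q ⁅ e ⁆) (q⊆p∪q _ _)

    D⊆B′∪⁅e⁆ : D ⊆ B′ ∪ ⁅ e ⁆
    D⊆B′∪⁅e⁆ = p⊆q∪⁅x⁆⇒p⊆q f∉D (⊆-trans D⊆C∪⁅e⁆∪B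
      (∪-lub (∪-lub (B⊆B′∪⁅e⁆∪⁅f⁆ ∘ C⊆B) (p⊆p∪q ⁅ f ⁆ ∘ q⊆p∪q B′ ⁅ e ⁆)) B⊆B′∪⁅e⁆∪⁅f⁆))

  cheapBasis-step : CheapBasis C′ C → ∣ C ∣ < p → GreedyStep G (suc p) T w C e → CheapBasis C′ (C ∪ ⁅ e ⁆)
  cheapBasis-step {e = e} cb ∣C∣<p e-step with e ∈? basis cb
  ... | no  e∉B = cheapBasis-exchange cb ∣C∣<p e-step e∉B
  ... | yes e∈B = record
    { basis  = basis cb
    ; good   = good cb
    ; size   = size cb
    ; ⊆basis = ∪-lub (⊆basis cb) (⁅x⁆⊆p e∈B)
    ; cheap  = cheap cb
    }

  cheapBasis : Feasible G (suc p) T w C′ → GreedyReach G (suc p) T w C → CheapBasis C′ C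
  cheapBasis feasible start                      = cheapBasis-⊥ feasible
  cheapBasis feasible (next e reach ∣C∣<p e-step) = cheapBasis-step (cheapBasis feasible reach) ∣C∣<p e-step

  greedy-step-exists : Feasible G (suc p) T w C′ → GreedyReach G (suc p) T w C → ∣ C ∣ < p →
                       ∃ λ e → GreedyStep G (suc p) T w C e
  greedy-step-exists {C′} {C} feasible reach ∣C∣<p =
    let e , (e∉C , good-C∪⁅e⁆) , e-minimal = cheapest in
    e , e∉C , good-C∪⁅e⁆ , λ e′ e′∉C good′ → e-minimal e′ (e′∉C , good′)
    where
    Extends : Fin m → Set
    Extends e = e ∉ C × Good G (suc p) T w (C ∪ ⁅ e ⁆)

    cb : CheapBasis C′ C
    cb = cheapBasis feasible reach

    some : ∃ Extends
    some = let e , _ , e∉C , good-C∪⁅e⁆ = augment-good (good-subset cb) (separated-family cb) (s≤s ∣C∣<p) in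
           e , e∉C , good-C∪⁅e⁆

    cheapest : ∃ λ e → Extends e × ∀ e′ → Extends e′ → w e ≤ w e′
    cheapest = minimiser (λ e → ¬? (e ∈? C) ×-dec good? (C ∪ ⁅ e ⁆)) w some

  greedy-optimal : Feasible G (suc p) T w C′ → GreedyReach G (suc p) T w C → ¬ (∣ C ∣ < p) →
                   Optimal G (suc p) T w C
  greedy-optimal {C = C} feasible reach ∣C∣≮p =
    Representatives⇒Feasible R ,
    λ C″ feasible″ → let cb″ = cheapBasis feasible″ reach in
                     ℚₚ.≤-trans (weight-mono G w w≥0 (⊆basis cb″)) (cheap cb″)
    where
    cb = cheapBasis feasible reach
    ∣C∣≡p : ∣ C ∣ ≡ p
    ∣C∣≡p = ℕₚ.≤-antisym (subst (∣ C ∣ ℕ.≤_) (size cb) (p⊆q⇒∣p∣≤∣q∣ (⊆basis cb))) (ℕₚ.≮⇒≥ ∣C∣≮p)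

    R : Representatives (suc p) C
    R = subst (λ k → Representatives (suc k) C) ∣C∣≡p (Good⇒Representatives (good-subset cb))

mainTheorem5 : (G : Graph) → IsTree G →
    (q : ℕ) (T : Fin q → Subset (Graph.n G)) (w : Fin (Graph.m G) → ℚ) →
    (∀ e → 0ℚ ≤ w e) →
    Σ (Subset (Graph.m G)) (Feasible G q T w) →
    ((C : Subset (Graph.m G)) → GreedyReach G q T w C → ∣ C ∣ < q ∸ 1 →
    ∃ λ e → GreedyStep G q T w C e)
    ×
    ((C : Subset (Graph.m G)) → GreedyReach G q T w C → ¬ (∣ C ∣ < q ∸ 1) →
    Optimal G q T w C)
mainTheorem5 G tree zero T w w≥0 _ =
  (λ _ _ ()) ,
  λ { _ start _ → ((λ ()) , (λ ()) , λ ()) , λ C″ _ → weight-mono G w w≥0 (⊆-min C″)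
    ; _ (next _ _ () _) _ }
mainTheorem5 G tree (suc p) T w w≥0 (_ , feasible) =
  (λ _ → greedy-step-exists feasible) , λ _ → greedy-optimal feasible
  where open Greedy G tree p T w w≥0
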